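{- Let $\mathbf{x}$ be a sequence over a finite alphabet. Then $r_{\mathbf{x}} (n) \leq r_{\mathbf{x}}(n+1) +1$ for all $n \geq 0$.
   Context: A factor of a sequence is a finite contiguous block. For $u=u(1)\cdots u(m)$, $u^R=u(m)\cdots u(1)$. $r_{\mathbf{x}}(n)$ is the number of distinct length-$n$ factors of $\mathbf{x}$ up to the equivalence $u\sim v\iff v\in\{u,u^R\}$. -}

module Defs where

open import Data.Nat using (ℕ; zero; suc; _+_)
open import Data.Fin using (Fin)
open import Data.Vec using (Vec; []; _∷_; reverse)
open import Data.List using (List)
open import Data.List.Membership.Propositional using (_∈_)
open import Data.List.Relation.Unary.AllPairs using (AllPairs)
open import Data.List.Relation.Unary.All using (All)
open import Data.List.Relation.Unary.Any using (Any)
open import Data.Product using (Σ; ∃; _×_)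
open import Data.Sum using (_⊎_)
open import Relation.Binary.PropositionalEquality using (_≡_)
open import Relation.Nullary using (¬_)

Seq : ℕ → Set
Seq k = ℕ → Fin k

window : ∀ {k} → Seq k → ℕ → (n : ℕ) → Vec (Fin k) n
window x i zero = []
window x i (suc n) = x i ∷ window x (suc i) n

IsFactor : ∀ {k n} → Seq k → Vec (Fin k) n → Set
IsFactor x u = ∃ λ i → u ≡ window x i _

_∼_ : ∀ {k n} → Vec (Fin k) n → Vec (Fin k) n → Set
u ∼ v = (v ≡ u) ⊎ (v ≡ reverse u)

-- RCount x n m : the number of distinct length-n factors of x up to ∼ is m,
-- i.e. there is a list of m factors, pairwise inequivalent, such that every
-- length-n factor is equivalent to one of them (a system of representatives).
RCount : ∀ {k} → Seq k → ℕ → ℕ → Set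
RCount {k} x n m =
  Σ (List (Vec (Fin k) n)) λ reps →
    (Data.List.length reps ≡ m)
    × All (IsFactor x) reps
    × AllPairs (λ u v → ¬ (u ∼ v)) reps
    × (∀ (w : Vec (Fin k) n) → IsFactor x w → Any (λ u → u ∼ w) reps)
  where import Data.List

{-# OPTIONS --safe #-}
-- Call p fresh for length n if the length-n factor at p is not equivalent to
-- any factor at an earlier position, so every class of length-n factors has
-- exactly one fresh position, its first occurrence. If p + 1 is fresh for
-- length n then p is fresh for length n + 1: a length-(n + 1) factor at j < p
-- equal to the one at p, or to its reversal, would have its length-n suffix,
-- or prefix, equivalent to the factor at p + 1. So sending each class that
-- first occurs at p + 1 to the class of the length-(n + 1) factor at p is
-- injective, and only the class first occurring at 0 is left over.
module Submission where

open import Defs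
open import Data.Nat using (ℕ; zero; suc; _≤_; _<_; _+_; s≤s)
open import Data.Nat.Properties using (<-cmp; n<1+n; m<n⇒m<1+n; m<1+n⇒m<n∨m≡n; +-comm; +-suc)
open import Data.Fin using (Fin; zero; suc)
import Data.Fin as Fin
open import Data.Fin.Properties using (injective⇒≤; suc-injective)
open import Data.Vec using (Vec; []; _∷_; _∷ʳ_; reverse; tail)
open import Data.Vec.Properties using (≡-dec; reverse-involutive; reverse-∷; ∷ʳ-injectiveˡ)
open import Data.List using (List; length; lookup)
open import Data.List.Membership.Propositional.Properties using (∈-lookup)
import Data.List.Relation.Unary.All as All
open import Data.List.Relation.Unary.All using (All)
open import Data.List.Relation.Unary.AllPairs using (AllPairs; _∷_)
open import Data.List.Relation.Unary.Any using (Any; index)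
open import Data.List.Relation.Unary.Any.Properties using (lookup-index)
open import Data.Product using (∃; _×_; _,_; proj₁)
open import Data.Sum using (_⊎_; inj₁; inj₂; [_,_]′)
open import Data.Empty using (⊥-elim)
open import Function.Definitions using (Injective)
open import Relation.Binary using (Rel; Symmetric; Transitive; tri<; tri≈; tri>)
open import Relation.Binary.PropositionalEquality using (_≡_; refl; sym; cong; subst; module ≡-Reasoning)
open import Relation.Nullary using (¬_; Dec; yes; no)
open import Relation.Nullary.Decidable using (_⊎-dec_)
open import Relation.Unary using (Decidable)

Least : (ℕ → Set) → ℕ → Set
Least P m = P m × (∀ {j} → j < m → ¬ P j)

module _ {P : ℕ → Set} (P? : Decidable P) where

  least-or-none-below : ∀ n → ∃ (Least P) ⊎ (∀ {j} → j < n → ¬ P j)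
  least-or-none-below zero = inj₂ λ ()
  least-or-none-below (suc n) with least-or-none-below n | P? n
  ... | inj₁ found | _      = inj₁ found
  ... | inj₂ none  | yes pn = inj₁ (n , pn , none)
  ... | inj₂ none  | no ¬pn = inj₂ λ j<1+n → [ none , (λ { refl → ¬pn }) ]′ (m<1+n⇒m<n∨m≡n j<1+n)

  least : ∀ {i} → P i → ∃ (Least P)
  least {i} pi with least-or-none-below (suc i)
  ... | inj₁ found = found
  ... | inj₂ none  = ⊥-elim (none (n<1+n i) pi)

module _ {k n : ℕ} where

  ∼-sym : Symmetric (_∼_ {k} {n})
  ∼-sym (inj₁ refl) = inj₁ refl
  ∼-sym {u} (inj₂ refl) = inj₂ (sym (reverse-involutive u))

  ∼-trans : Transitive (_∼_ {k} {n})
  ∼-trans (inj₁ refl) v∼w = v∼w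
  ∼-trans (inj₂ refl) (inj₁ refl) = inj₂ refl
  ∼-trans {u} (inj₂ refl) (inj₂ refl) = inj₁ (reverse-involutive u)

  _∼?_ : (u v : Vec (Fin k) n) → Dec (u ∼ v)
  u ∼? v = ≡-dec Fin._≟_ v u ⊎-dec ≡-dec Fin._≟_ v (reverse u)

  index-≡⇒∼ : ∀ {u v} {B : List (Vec (Fin k) n)} (p : Any (_∼ u) B) (q : Any (_∼ v) B) →
              index p ≡ index q → u ∼ v
  index-≡⇒∼ {B = B} p q eq =
    ∼-trans (∼-sym (lookup-index p)) (subst (_∼ _) (cong (lookup B) (sym eq)) (lookup-index q))

lookup-injective : ∀ {a r} {A : Set a} {R : Rel A r} {xs : List A} → Symmetric R →
                   AllPairs (λ u v → ¬ R u v) xs → ∀ i j → R (lookup xs i) (lookup xs j) → i ≡ j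
lookup-injective sym-R (_ ∷ _)         zero    zero    _ = refl
lookup-injective sym-R (x-distinct ∷ _)  zero    (suc j) r = ⊥-elim (All.lookup x-distinct (∈-lookup j) r)
lookup-injective sym-R (x-distinct ∷ _)  (suc i) zero    r = ⊥-elim (All.lookup x-distinct (∈-lookup i) (sym-R r))
lookup-injective sym-R (_ ∷ distinct)  (suc i) (suc j) r = cong suc (lookup-injective sym-R distinct i j r)

window-∷ʳ : ∀ {k} (x : Seq k) i n → window x i (suc n) ≡ window x i n ∷ʳ x (i + n)
window-∷ʳ x i zero    = cong (λ j → x j ∷ []) (+-comm 0 i)
window-∷ʳ x i (suc n) rewrite +-suc i n = cong (x i ∷_) (window-∷ʳ x (suc i) n)

module _ {k : ℕ} (x : Seq k) where

  FreshAt : ℕ → ℕ → Set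
  FreshAt n p = ∀ {j} → j < p → ¬ window x p n ∼ window x j n

  first-occurrence : ∀ {n} {u : Vec (Fin k) n} → IsFactor x u → ∃ λ p → u ∼ window x p n × FreshAt n p
  first-occurrence {n} {u} (i , refl) with least (λ m → u ∼? window x m n) (inj₁ refl)
  ... | p , u∼p , earliest = p , u∼p , λ j<p p∼j → earliest j<p (∼-trans u∼p p∼j)

  FreshAt-unique : ∀ {n p q} → FreshAt n p → FreshAt n q → window x p n ∼ window x q n → p ≡ q
  FreshAt-unique {p = p} {q} fresh-p fresh-q p∼q with <-cmp p q
  ... | tri< p<q _ _ = ⊥-elim (fresh-q p<q (∼-sym p∼q))
  ... | tri≈ _ p≡q _ = p≡q
  ... | tri> _ _ q<p = ⊥-elim (fresh-p q<p p∼q)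

  FreshAt-extend : ∀ {n p} → FreshAt n (suc p) → FreshAt (suc n) p
  FreshAt-extend fresh j<p (inj₁ eq) = fresh (s≤s j<p) (inj₁ (cong tail eq))
  FreshAt-extend {n} {p} fresh {j} j<p (inj₂ eq) =
    fresh (m<n⇒m<1+n j<p) (inj₂ (∷ʳ-injectiveˡ _ _ (begin
      window x j n ∷ʳ x (j + n)            ≡⟨ window-∷ʳ x j n ⟨
      window x j (suc n)                   ≡⟨ eq ⟩
      reverse (x p ∷ window x (suc p) n)   ≡⟨ reverse-∷ (x p) (window x (suc p) n) ⟩
      reverse (window x (suc p) n) ∷ʳ x p  ∎)))
    where open ≡-Reasoning

module _ {k : ℕ} (x : Seq k) {n : ℕ}
         {A : List (Vec (Fin k) n)} {B : List (Vec (Fin k) (suc n))}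
         (A-factors : All (IsFactor x) A)
         (A-distinct : AllPairs (λ u v → ¬ u ∼ v) A)
         (B-covers : ∀ w → IsFactor x w → Any (_∼ w) B) where

  code : ℕ → Fin (suc (length B))
  code zero    = zero
  code (suc p) = suc (index (B-covers (window x p (suc n)) (p , refl)))

  code-injective : ∀ {p q} → FreshAt x n p → FreshAt x n q → code p ≡ code q → p ≡ q
  code-injective {zero}  {zero}  _       _       _  = refl
  code-injective {suc p} {suc q} fresh-p fresh-q eq =
    cong suc (FreshAt-unique x (FreshAt-extend x fresh-p) (FreshAt-extend x fresh-q)
                             (index-≡⇒∼ _ _ (suc-injective eq)))

  occurrence : (i : Fin (length A)) → ∃ λ p → lookup A i ∼ window x p n × FreshAt x n p
  occurrence i = first-occurrence x (All.lookup A-factors (∈-lookup i))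

  classify : Fin (length A) → Fin (suc (length B))
  classify i = code (proj₁ (occurrence i))

  classify-injective : Injective _≡_ _≡_ classify
  classify-injective {i} {j} eq with occurrence i | occurrence j
  ... | p , i∼p , fresh-p | q , j∼q , fresh-q with code-injective fresh-p fresh-q eq
  ... | refl = lookup-injective ∼-sym A-distinct i j (∼-trans i∼p (∼-sym j∼q))

RCount-suc : ∀ {k} (x : Seq k) {n a b} → RCount x n a → RCount x (suc n) b → a ≤ suc b
RCount-suc x (_ , refl , A-factors , A-distinct , _) (_ , refl , _ , _ , B-covers) =
  injective⇒≤ (classify-injective x A-factors A-distinct B-covers)

theorem4p1 : ∀ {k : ℕ} (x : Seq k) (n a b : ℕ) →
    RCount x n a → RCount x (n + 1) b → a ≤ b + 1
theorem4p1 x n a b ra rb =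
  subst (a ≤_) (+-comm 1 b) (RCount-suc x ra (subst (λ m → RCount x m b) (+-comm n 1) rb))
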